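{- Let $\alpha=(a_1,\dots,a_n)$ be a sequence of reals with QN-list $\mathbb{L}_\alpha$, and fix $0<L_I\le U_I<n$ and $0\le L_V\le U_V$. Let $a_i\in\mathbb{L}_\alpha^{t+1}$ and let $a_k\in\mathbb{L}_\alpha^t$ be the leftmost non-black item of $\mathbb{L}_\alpha^t$ satisfying $L_V\le a_i-a_k$ and $i-k\le U_I$. Then $a_i$ has a range-proper predecessor if and only if $a_k$ is range-proper to $a_i$.
   Context: Items are identified with their positions. An increasing subsequence is a subsequence $a_{i_1},\dots,a_{i_k}$, $i_1<\dots<i_k$, with $a_{i_1}\le\dots\le a_{i_k}$; the rising length of $a_i$ is the maximum length of an increasing subsequence ending with $a_i$; $a_j$ is a predecessor of $a_i$ if $j<i$, $a_j\le a_i$ and the rising length of $a_j$ is one less than that of $a_i$. The horizontal list $\mathbb{L}_\alpha^t$ lists the items of rising length $t$ in increasing order of position ("leftmost" = smallest position); $\mathbb{L}_\alpha$ is the collection of these lists. Coloring for the range constraint: every item of $\mathbb{L}_\alpha^1$ is non-black; recursively, $a_i\in\mathbb{L}_\alpha^{t+1}$ is non-black iff it has a range-proper predecessor, black otherwise. An item $a_j$ is range-proper to $a_i$ (a range-proper predecessor of $a_i$) if $a_j$ is a non-black predecessor of $a_i$ with $L_V\le a_i-a_j\le U_V$ and $L_I\le i-j\le U_I$. -}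

module Defs where

open import Level using (Level; _⊔_) renaming (suc to lsuc)
open import Data.Nat using (ℕ; suc; _∸_) renaming (_<_ to _<ℕ_; _≤_ to _≤ℕ_)
open import Data.Fin using (Fin; toℕ)
open import Data.Product using (_×_; ∃)
open import Relation.Binary using (Rel; IsTotalOrder)
open import Algebra.Bundles using (CommutativeRing)

-- The reals enter the statement only as a totally ordered commutative ring
-- (order compatible with + and with products of non-negatives).
record OrderedCommRing (c ℓ₁ ℓ₂ : Level) : Set (lsuc (c ⊔ ℓ₁ ⊔ ℓ₂)) where
  field
    commRing : CommutativeRing c ℓ₁
  open CommutativeRing commRing public
  infix 4 _≤_
  field
    _≤_          : Rel Carrier ℓ₂
    isTotalOrder : IsTotalOrder _≈_ _≤_
    +-mono-≤     : ∀ {x y} z → x ≤ y → x + z ≤ y + z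
    *-nonneg     : ∀ {x y} → 0# ≤ x → 0# ≤ y → 0# ≤ x * y

-- A sequence α = (a_1,…,a_n), positions are Fin n (position p ↔ index toℕ p + 1;
-- only differences and order of positions matter).
module Seq {c ℓ₁ ℓ₂} (R : OrderedCommRing c ℓ₁ ℓ₂) {n : ℕ} (a : Fin n → OrderedCommRing.Carrier R) where
  open OrderedCommRing R

  data Chain : Fin n → ℕ → Set (c ⊔ ℓ₂) where
    single : ∀ i → Chain i 1
    extend : ∀ {j i m} → toℕ j <ℕ toℕ i → a j ≤ a i → Chain j m → Chain i (suc m)

  -- RL i t : the rising length of a_i is t  (i.e. a_i ∈ 𝕃^t).
  RL : Fin n → ℕ → Set (c ⊔ ℓ₂)
  RL i t = Chain i t × (∀ m → Chain i m → m ≤ℕ t)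

  Pred : Fin n → Fin n → Set (c ⊔ ℓ₂)
  Pred j i = toℕ j <ℕ toℕ i × a j ≤ a i × ∃ λ t → RL j t × RL i (suc t)

  module Range (LV UV : Carrier) (LI UI : ℕ) where

    Window : Fin n → Fin n → Set ℓ₂
    Window j i = (LV ≤ a i - a j × a i - a j ≤ UV)
               × (LI ≤ℕ toℕ i ∸ toℕ j × toℕ i ∸ toℕ j ≤ℕ UI)

    -- Items of rising length 1 are non-black;
    -- an item of rising length t+1 is non-black iff it has a range-proper
    -- predecessor (least fixed point of the recursive definition, which is
    -- well-founded on rising length).
    data NonBlack : Fin n → Set (c ⊔ ℓ₁ ⊔ ℓ₂) where
      nb-one  : ∀ {i} → RL i 1 → NonBlack i
      nb-pred : ∀ {i} j → NonBlack j → Pred j i → Window j i → NonBlack i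

    RangeProper : Fin n → Fin n → Set (c ⊔ ℓ₁ ⊔ ℓ₂)
    RangeProper j i = NonBlack j × Pred j i × Window j i

-- If a_j is range-proper to a_i, then a_j lies on level t of the horizontal list, so the
-- leftmost candidate a_k satisfies k ≤ j.  Items of one level weakly decrease from left
-- to right (a larger item further right would have a longer increasing subsequence), so
-- a_k ≤ a_j.  Moving from a_j to a_k therefore only enlarges a_i - a_k and i - k, which
-- keeps the upper value bound U_V and the lower index bound L_I; the remaining bounds
-- hold for a_k by its choice.
module Submission where

open import Defs
open import Data.Nat using (ℕ; suc; _∸_; _<_; _≤_)
open import Data.Nat.Properties using (≤-antisym; ≤-trans; ≤-<-trans; suc-injective; m≤n⇒m<n∨m≡n; n≮n; ∸-monoʳ-≤)
open import Data.Fin using (Fin; toℕ)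
open import Data.Fin.Properties using (toℕ-injective)
open import Data.Product using (∃; _,_)
open import Data.Sum using (inj₁; inj₂)
open import Data.Empty using (⊥-elim)
open import Function.Bundles using (_⇔_; mk⇔)
open import Relation.Binary using (IsTotalOrder)
open import Relation.Binary.Bundles using (Poset)
open import Relation.Binary.PropositionalEquality using (_≡_; subst)
import Algebra.Properties.Group as GroupProperties
import Relation.Binary.Reasoning.PartialOrder as PartialOrderReasoning

module OrderedCommRingProperties {c ℓ₁ ℓ₂} (R : OrderedCommRing c ℓ₁ ℓ₂) where
  open OrderedCommRing R renaming (_≤_ to _≼_)
  open IsTotalOrder isTotalOrder using (isPartialOrder) renaming (trans to ≼-trans)
  open GroupProperties +-group using (//-rightDividesˡ)

  poset : Poset c ℓ₁ ℓ₂
  poset = record { isPartialOrder = isPartialOrder }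

  open PartialOrderReasoning poset

  x-y≥0⇒y≤x : ∀ {x y} → 0# ≼ x - y → y ≼ x
  x-y≥0⇒y≤x {x} {y} 0≤x-y = begin
    y            ≈⟨ +-identityˡ y ⟨
    0# + y       ≤⟨ +-mono-≤ y 0≤x-y ⟩
    (x - y) + y  ≈⟨ //-rightDividesˡ y x ⟩
    x            ∎

  neg-antimono-≼ : ∀ {y z} → y ≼ z → - z ≼ - y
  neg-antimono-≼ {y} {z} y≤z = begin
    - z                ≈⟨ +-identityˡ (- z) ⟨
    0# + - z           ≈⟨ +-congʳ (-‿inverseʳ y) ⟨
    (y + - y) + - z    ≈⟨ +-assoc y (- y) (- z) ⟩
    y + (- y + - z)    ≤⟨ +-mono-≤ (- y + - z) y≤z ⟩
    z + (- y + - z)    ≈⟨ +-congˡ (+-comm (- y) (- z)) ⟩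
    z + (- z + - y)    ≈⟨ +-assoc z (- z) (- y) ⟨
    (z + - z) + - y    ≈⟨ +-congʳ (-‿inverseʳ z) ⟩
    0# + - y           ≈⟨ +-identityˡ (- y) ⟩
    - y                ∎

  sub-antimonoʳ-≼ : ∀ {x y z} → y ≼ z → x - z ≼ x - y
  sub-antimonoʳ-≼ {x} {y} {z} y≤z = begin
    x - z     ≈⟨ +-comm x (- z) ⟩
    - z + x   ≤⟨ +-mono-≤ x (neg-antimono-≼ y≤z) ⟩
    - y + x   ≈⟨ +-comm (- y) x ⟩
    x - y     ∎

  ≼-sub⇒≼ : ∀ {l x y} → 0# ≼ l → l ≼ x - y → y ≼ x
  ≼-sub⇒≼ 0≤l l≤x-y = x-y≥0⇒y≤x (≼-trans 0≤l l≤x-y)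

module SequenceProperties {c ℓ₁ ℓ₂} (R : OrderedCommRing c ℓ₁ ℓ₂) {n : ℕ}
         (a : Fin n → OrderedCommRing.Carrier R) where
  open OrderedCommRing R renaming (_≤_ to _≼_)
  open IsTotalOrder isTotalOrder using (total) renaming (refl to ≼-refl; trans to ≼-trans)
  open OrderedCommRingProperties R
  open Seq R a

  RL-functional : ∀ {i s t} → RL i s → RL i t → s ≡ t
  RL-functional (chain-s , max-s) (chain-t , max-t) = ≤-antisym (max-t _ chain-s) (max-s _ chain-t)

  Pred⇒RL : ∀ {j i t} → Pred j i → RL i (suc t) → RL j t
  Pred⇒RL {j} (_ , _ , _ , rl-j , rl-i′) rl-i =
    subst (RL j) (suc-injective (RL-functional rl-i′ rl-i)) rl-j

  RL-antitone : ∀ {j k t} → toℕ k ≤ toℕ j → RL k t → RL j t → a j ≼ a k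
  RL-antitone {j} {k} k≤j (chain-k , _) (_ , maximal-j) with m≤n⇒m<n∨m≡n k≤j
  ... | inj₂ k≡j rewrite toℕ-injective k≡j = ≼-refl
  ... | inj₁ k<j with total (a k) (a j)
  ...   | inj₂ aj≤ak = aj≤ak
  ...   | inj₁ ak≤aj = ⊥-elim (n≮n _ (maximal-j _ (Chain.extend k<j ak≤aj chain-k)))

  module _ (LV UV : Carrier) (LI UI : ℕ) where
    open Range LV UV LI UI

    rangeProper-leftward : ∀ {i j k t} → 0# ≼ LV → RL i (suc t) → RL k t → NonBlack k →
      LV ≼ a i - a k → toℕ i ∸ toℕ k ≤ UI → toℕ k ≤ toℕ j →
      RangeProper j i → RangeProper k i
    rangeProper-leftward {i} {j} {k} {t} 0≤LV rl-i rl-k nb-k LV≤ai-ak i-k≤UI k≤j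
      (_ , pred-ji@(j<i , _ , _) , (_ , ai-aj≤UV) , (LI≤i-j , _)) =
      nb-k , (k<i , ak≤ai , t , rl-k , rl-i) , (LV≤ai-ak , ai-ak≤UV) , (LI≤i-k , i-k≤UI)
      where
      k<i : toℕ k < toℕ i
      k<i = ≤-<-trans k≤j j<i
      ak≤ai : a k ≼ a i
      ak≤ai = ≼-sub⇒≼ 0≤LV LV≤ai-ak
      ai-ak≤UV : a i - a k ≼ UV
      ai-ak≤UV = ≼-trans (sub-antimonoʳ-≼ (RL-antitone k≤j rl-k (Pred⇒RL pred-ji rl-i))) ai-aj≤UV
      LI≤i-k : LI ≤ toℕ i ∸ toℕ k
      LI≤i-k = ≤-trans LI≤i-j (∸-monoʳ-≤ (toℕ i) k≤j)

theorem10 : ∀ {c ℓ₁ ℓ₂} (R : OrderedCommRing c ℓ₁ ℓ₂) (n : ℕ)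
    (a : Fin n → OrderedCommRing.Carrier R)
    (LI UI : ℕ) (LV UV : OrderedCommRing.Carrier R) →
    0 < LI → LI ≤ UI → UI < n →
    OrderedCommRing._≤_ R (OrderedCommRing.0# R) LV → OrderedCommRing._≤_ R LV UV →
    (i k : Fin n) (t : ℕ) →
    Seq.RL R a i (suc t) →
    Seq.RL R a k t →
    Seq.Range.NonBlack R a LV UV LI UI k →
    OrderedCommRing._≤_ R LV (OrderedCommRing._-_ R (a i) (a k)) →
    toℕ i ∸ toℕ k ≤ UI →
    (∀ j → Seq.RL R a j t → Seq.Range.NonBlack R a LV UV LI UI j →
      OrderedCommRing._≤_ R LV (OrderedCommRing._-_ R (a i) (a j)) →
      toℕ i ∸ toℕ j ≤ UI → toℕ k ≤ toℕ j) →
    (∃ (λ j → Seq.Range.RangeProper R a LV UV LI UI j i))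
      ⇔ Seq.Range.RangeProper R a LV UV LI UI k i
theorem10 R n a LI UI LV UV _ _ _ 0≤LV _ i k t rl-i rl-k nb-k LV≤ai-ak i-k≤UI leftmost =
  mk⇔ to (k ,_)
  where
  open Seq R a
  open SequenceProperties R a
  to : ∃ (λ j → Range.RangeProper LV UV LI UI j i) → Range.RangeProper LV UV LI UI k i
  to (j , proper-ji@(nb-j , pred-ji , (LV≤ai-aj , _) , (_ , i-j≤UI))) =
    rangeProper-leftward LV UV LI UI 0≤LV rl-i rl-k nb-k LV≤ai-ak i-k≤UI
      (leftmost j (Pred⇒RL pred-ji rl-i) nb-j LV≤ai-aj i-j≤UI) proper-ji
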